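{- Let $(S,\to,s^0)$ be a finite labeled transition system over a finite action set ${\sf Act}$ containing $\tau$, let $\langle A_?,A_>\rangle$ be a well-founded partition of ${\sf Act}$ for it with $\tau\in A_>$, let $\pi_0:S\to\mathbb{N}$ be arbitrary, let $h_1,h_2,\dots:\mathbb{N}\times{\sf Sig}\to\mathbb{N}$ be bijections, and let $\pi_i$ be the inductive branching partitions defined in the context. Write $s\mathrel{\underline{\leftrightarrow}}_i t$ iff $\pi_i(s)=\pi_i(t)$. If for some $i\ge0$ we have, for all $s,t\in S$, $s\mathrel{\underline{\leftrightarrow}}_i t\Leftrightarrow s\mathrel{\underline{\leftrightarrow}}_{i+1}t$, then $\mathrel{\underline{\leftrightarrow}}_i$ is a branching bisimulation.
   Context: A labeled transition system (LTS) is a triple $(S,\to,s^0)$ with $\to\subseteq S\times{\sf Act}\times S$; write $s\xrightarrow{a}t$ for $(s,a,t)\in\to$; $\xrightarrow{\tau}^*$ is the reflexive transitive closure of $\xrightarrow{\tau}$. A symmetric relation $R\subseteq S\times S$ is a branching bisimulation if whenever $s\,R\,t$ and $s\xrightarrow{a}s'$, either ($a=\tau$ and $s'\,R\,t$) or there are $t',t''$ with $t\xrightarrow{\tau}^*t'$, $s\,R\,t'$, $t'\xrightarrow{a}t''$, $s'\,R\,t''$. ${\sf Sig}$ is the set of finite subsets of ${\sf Act}\times\mathbb{N}$. A well-founded partition of ${\sf Act}$ for the LTS is a pair $\langle A_?,A_>\rangle$ with $A_?\cap A_>=\emptyset$, $A_?\cup A_>={\sf Act}$, such that there is no cycle of transitions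 labeled with actions in $A_>$; let $>$ be the transitive closure of $\bigcup_{a\in A_>}\xrightarrow{a}$. Given $\pi_i:S\to\mathbb{N}$, define $pre_{i+1}$, $sig_{i+1}$, $\pi_{i+1}$ simultaneously by well-founded recursion on $>$: $pre_{i+1}(s)=\{(a,\pi_i(t))\mid s\xrightarrow{a}t,\ a\in A_?\}\cup\{(a,\pi_{i+1}(t))\mid s\xrightarrow{a}t,\ a\in A_>\}$; $sig_{i+1}(s)=sig_{i+1}(t)$ for some $t$ with $s\xrightarrow{\tau}t$, $\pi_i(s)=\pi_i(t)$ and $pre_{i+1}(s)\subseteq sig_{i+1}(t)\cup\{(\tau,\pi_{i+1}(t))\}$, if such a $t$ exists (all such $t$ give the same value); otherwise $sig_{i+1}(s)=pre_{i+1}(s)$; $\pi_{i+1}(s)=h_{i+1}(\pi_i(s),sig_{i+1}(s))$. -}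

module Defs where

open import Data.Nat using (ℕ; suc)
open import Data.Fin using (Fin)
open import Data.Bool using (Bool; T; not)
open import Data.List using (List)
open import Data.List.Membership.Propositional using (_∈_)
open import Data.Product using (_×_; _,_; ∃; ∃₂)
open import Data.Sum using (_⊎_)
open import Relation.Nullary using (¬_)
open import Relation.Binary.PropositionalEquality using (_≡_)
open import Relation.Binary.Construct.Closure.Transitive using (TransClosure)
open import Relation.Binary.Construct.Closure.ReflexiveTransitive using (Star)

record LTS (n m : ℕ) : Set where
  field
    step : Fin n → Fin m → Fin n → Bool
    s⁰   : Fin n

module _ {n m : ℕ} (L : LTS n m) where
  open LTS L

  Tr : Fin n → Fin m → Fin n → Set
  Tr s a t = T (step s a t)

  IsBranchingBisim : (τ : Fin m) → (Fin n → Fin n → Set) → Set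
  IsBranchingBisim τ R =
    (∀ {s t} → R s t → R t s) ×
    (∀ {s t s' a} → R s t → Tr s a s' →
       (a ≡ τ × R s' t) ⊎
       ∃₂ λ t' t'' → Star (λ x y → Tr x τ y) t t' × R s t' × Tr t' a t'' × R s' t'')

  -- ⟨A?, A>⟩ given by A> : Fin m → Bool, with A? = complement.
  -- Well-founded: no cycle of transitions labeled with actions in A>.
  IsWellFoundedPartition : (Fin m → Bool) → Set
  IsWellFoundedPartition A> =
    ∀ s → ¬ TransClosure (λ x y → ∃ λ a → T (A> a) × Tr x a y) s s

-- Sig: finite subsets of Act × ℕ, represented by lists up to set equality ≋.
Sig : ℕ → Set
Sig m = List (Fin m × ℕ)

_≋_ : ∀ {m} → Sig m → Sig m → Set
X ≋ Y = ∀ x → (x ∈ X → x ∈ Y) × (x ∈ Y → x ∈ X)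

-- h : ℕ × Sig → ℕ is a bijection (on ℕ × (Sig / ≋)):
-- well defined, injective and surjective.
IsBijection : ∀ {m} → (ℕ → Sig m → ℕ) → Set
IsBijection h =
  (∀ p X Y → X ≋ Y → h p X ≡ h p Y) ×
  (∀ p q X Y → h p X ≡ h q Y → p ≡ q × X ≋ Y) ×
  (∀ k → ∃₂ λ p X → h p X ≡ k)

module _ {n m : ℕ} (L : LTS n m) (τ : Fin m) (A> : Fin m → Bool)
         (π : ℕ → Fin n → ℕ) where

  -- (a , k) ∈ pre_{i+1}(s)
  InPre : ℕ → Fin n → Fin m → ℕ → Set
  InPre i s a k = ∃ λ t → Tr L s a t ×
    ((T (not (A> a)) × k ≡ π i t) ⊎ (T (A> a) × k ≡ π (suc i) t))

  SigCand : (sig : ℕ → Fin n → Sig m) → ℕ → Fin n → Fin n → Set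
  SigCand sig i s t = Tr L s τ t × π i s ≡ π i t ×
    (∀ a k → InPre i s a k → (a , k) ∈ sig (suc i) t ⊎ (a ≡ τ × k ≡ π (suc i) t))

IsInductiveBranchingPartition : ∀ {n m} (L : LTS n m) (τ : Fin m) (A> : Fin m → Bool)
  (h : ℕ → ℕ → Sig m → ℕ) (π : ℕ → Fin n → ℕ) (sig : ℕ → Fin n → Sig m) → Set
IsInductiveBranchingPartition L τ A> h π sig = ∀ i s →
  (π (suc i) s ≡ h (suc i) (π i s) (sig (suc i) s)) ×
  ((∃ λ t → SigCand L τ A> π sig i s t × sig (suc i) s ≋ sig (suc i) t) ⊎
   ((¬ ∃ λ t → SigCand L τ A> π sig i s t) ×
    (∀ a k → ((a , k) ∈ sig (suc i) s → InPre L τ A> π i s a k) ×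
             (InPre L τ A> π i s a k → (a , k) ∈ sig (suc i) s))))

module Submission where

open import Level using (_⊔_)
open import Data.Nat using (ℕ; zero; suc; _<_; _≤_; s≤s)
open import Data.Nat.Properties using (m<1+n⇒m<n∨m≡n; ≤-refl; <⇒≤; ≤-trans; n≤1+n)
open import Data.Fin using (Fin; toℕ)
open import Data.Fin.Properties using (pigeonhole; toℕ<n)
open import Data.Bool using (Bool; T; not; true; false)
open import Data.Product using (_×_; _,_; ∃; proj₁; proj₂)
open import Data.Sum using (_⊎_; inj₁; inj₂)
open import Data.Empty using (⊥-elim)
open import Data.List.Membership.Propositional using (_∈_)
open import Relation.Nullary using (¬_)
open import Relation.Binary.Core using (Rel)
open import Relation.Binary.PropositionalEquality using (_≡_; refl; sym; trans; subst)
open import Relation.Binary.Construct.Closure.Transitive using (TransClosure; [_]; _∷_; _++_)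
open import Relation.Binary.Construct.Closure.ReflexiveTransitive using (Star; ε; _◅_)
open import Defs

-- Stability of π_i forces equivalent states to have equal (up to ≋)
-- signatures, by injectivity of h_{i+1}. A transition s --a--> s' is either inert
-- or contributes (a, k) to sig_{i+1}(s), and every element of sig_{i+1}(t) is
-- already an element of pre_{i+1}(t') for a state t' reached from t by inert
-- τ-steps. The latter follows by following the τ-candidates in the definition of
-- sig_{i+1}, which terminates because τ ∈ A> and A>-transitions have no cycles.

module _ {a ℓ} {A : Set a} (R : Rel A ℓ) where

  Walk : ℕ → A → Set (a ⊔ ℓ)
  Walk K u = ∃ λ (f : ℕ → A) → f 0 ≡ u × (∀ j → j < K → R (f j) (f (suc j)))

  Acyclic : Set (a ⊔ ℓ)
  Acyclic = ∀ x → ¬ TransClosure R x x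

  walk-cons : ∀ {K u v} → R u v → Walk K v → Walk (suc K) u
  walk-cons {u = u} uRv (f , refl , steps) = g , refl , steps′
    where
    g : ℕ → A
    g zero = u
    g (suc j) = f j

    steps′ : ∀ j → j < suc _ → R (g j) (g (suc j))
    steps′ zero _ = uRv
    steps′ (suc j) (s≤s j<K) = steps j j<K

  walk⇒TransClosure : ∀ {K} (f : ℕ → A) → (∀ j → j < K → R (f j) (f (suc j))) →
                      ∀ {j k} → j < k → k ≤ K → TransClosure R (f j) (f k)
  walk⇒TransClosure f steps {j} {suc k} j<1+k 1+k≤K with m<1+n⇒m<n∨m≡n j<1+k
  ... | inj₂ refl = [ steps j 1+k≤K ]
  ... | inj₁ j<k  = walk⇒TransClosure f steps j<k (≤-trans (n≤1+n k) 1+k≤K)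
                    ++ [ steps k 1+k≤K ]

  Descending : ∀ {p} → (A → Set p) → Set _
  Descending P = ∀ u → P u ⊎ ∃ λ v → R u v × (P v → P u)

  descend-or-walk : ∀ {p} {P : A → Set p} → Descending P → ∀ K u → P u ⊎ Walk K u
  descend-or-walk desc zero u = inj₂ ((λ _ → u) , refl , λ _ ())
  descend-or-walk desc (suc K) u with desc u
  ... | inj₁ Pu = inj₁ Pu
  ... | inj₂ (v , uRv , back) with descend-or-walk desc K v
  ...   | inj₁ Pv = inj₁ (back Pv)
  ...   | inj₂ w  = inj₂ (walk-cons uRv w)

module _ {n ℓ} {R : Rel (Fin n) ℓ} where

  acyclic⇒¬Walk : Acyclic R → ∀ {u} → ¬ Walk R (suc n) u
  acyclic⇒¬Walk acyclic (f , _ , steps)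
    with j , k , j<k , fj≡fk ← pigeonhole ≤-refl (λ (x : Fin (suc n)) → f (toℕ x))
    = acyclic (f (toℕ j)) (subst (TransClosure R (f (toℕ j))) (sym fj≡fk)
        (walk⇒TransClosure R f steps j<k (<⇒≤ (toℕ<n k))))

  acyclic-descent : ∀ {p} {P : Fin n → Set p} → Acyclic R → Descending R P → ∀ u → P u
  acyclic-descent acyclic desc u with descend-or-walk R desc (suc n) u
  ... | inj₁ Pu = Pu
  ... | inj₂ w  = ⊥-elim (acyclic⇒¬Walk acyclic w)

module StablePartition {n m} (L : LTS n m) (τ : Fin m) (A> : Fin m → Bool)
    (wf : IsWellFoundedPartition L A>) (τ∈A> : T (A> τ))
    (h : ℕ → ℕ → Sig m → ℕ) (h-bij : ∀ i → IsBijection (h (suc i)))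
    (π : ℕ → Fin n → ℕ) (sig : ℕ → Fin n → Sig m)
    (ibp : IsInductiveBranchingPartition L τ A> h π sig)
    (i : ℕ)
    (stable : ∀ s t → (π i s ≡ π i t → π (suc i) s ≡ π (suc i) t) ×
                      (π (suc i) s ≡ π (suc i) t → π i s ≡ π i t)) where

  _~_ : Fin n → Fin n → Set
  s ~ t = π i s ≡ π i t

  _⟶τ_ : Fin n → Fin n → Set
  s ⟶τ t = Tr L s τ t

  sig-cong : ∀ {s t} → s ~ t → sig (suc i) s ≋ sig (suc i) t
  sig-cong {s} {t} s~t = proj₂ (proj₁ (proj₂ (h-bij i)) _ _ _ _ h-eq)
    where
    h-eq : h (suc i) (π i s) (sig (suc i) s) ≡ h (suc i) (π i t) (sig (suc i) t)
    h-eq = trans (sym (proj₁ (ibp i s))) (trans (proj₁ (stable s t) s~t) (proj₁ (ibp i t)))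

  preValue : Fin m → Fin n → ℕ
  preValue a s' with A> a
  ... | true  = π (suc i) s'
  ... | false = π i s'

  preValue-A> : ∀ {a} → T (A> a) → ∀ s' → preValue a s' ≡ π (suc i) s'
  preValue-A> {a} a∈A> s' with A> a
  ... | true = refl

  transition∈pre : ∀ {s a s'} → Tr L s a s' → InPre L τ A> π i s a (preValue a s')
  transition∈pre {a = a} {s'} tr with A> a
  ... | true  = s' , tr , inj₂ (_ , refl)
  ... | false = s' , tr , inj₁ (_ , refl)

  preValue-reflects-~ : ∀ a s' t'' →
    (T (not (A> a)) × preValue a s' ≡ π i t'') ⊎ (T (A> a) × preValue a s' ≡ π (suc i) t'') →
    s' ~ t''
  preValue-reflects-~ a s' t'' match with A> a | match
  ... | true  | inj₂ (_ , eq) = proj₂ (stable s' t'') eq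
  ... | false | inj₁ (_ , eq) = eq

  inert⊎∈sig : ∀ {s a s'} → Tr L s a s' →
               (a ≡ τ × s' ~ s) ⊎ ((a , preValue a s') ∈ sig (suc i) s)
  inert⊎∈sig {s} {a} {s'} tr with proj₂ (ibp i s)
  ... | inj₂ (_ , sig≡pre) = inj₂ (proj₂ (sig≡pre a (preValue a s')) (transition∈pre tr))
  ... | inj₁ (c , (_ , s~c , covered) , sig≋) with covered a (preValue a s') (transition∈pre tr)
  ...   | inj₁ ∈sig-c     = inj₂ (proj₂ (sig≋ (a , preValue a s')) ∈sig-c)
  ...   | inj₂ (refl , eq) =
          inj₁ (refl , trans (proj₂ (stable s' c) (trans (sym (preValue-A> τ∈A> s')) eq)) (sym s~c))

  RealisedBelow : Fin n → Set
  RealisedBelow u = ∀ a k → (a , k) ∈ sig (suc i) u →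
    ∃ λ u' → Star _⟶τ_ u u' × u' ~ u × InPre L τ A> π i u' a k

  A>-step : Rel (Fin n) _
  A>-step x y = ∃ λ a → T (A> a) × Tr L x a y

  realisedBelow : ∀ u → RealisedBelow u
  realisedBelow = acyclic-descent wf descending
    where
    descending : Descending A>-step RealisedBelow
    descending u with proj₂ (ibp i u)
    ... | inj₂ (_ , sig≡pre) = inj₁ λ a k ∈sig → u , ε , refl , proj₁ (sig≡pre a k) ∈sig
    ... | inj₁ (c , (u⟶c , u~c , _) , sig≋) = inj₂ (c , (τ , τ∈A> , u⟶c) , back)
      where
      back : RealisedBelow c → RealisedBelow u
      back real-c a k ∈sig with real-c a k (proj₁ (sig≋ (a , k)) ∈sig)
      ... | u' , c⟶*u' , u'~c , pre = u' , u⟶c ◅ c⟶*u' , trans u'~c (sym u~c) , pre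

  isBranchingBisim : IsBranchingBisim L τ _~_
  isBranchingBisim = sym , transfer
    where
    transfer : ∀ {s t s' a} → s ~ t → Tr L s a s' →
      (a ≡ τ × s' ~ t) ⊎
      ∃ λ t' → ∃ λ t'' → Star _⟶τ_ t t' × s ~ t' × Tr L t' a t'' × s' ~ t''
    transfer {s} {t} {s'} {a} s~t tr with inert⊎∈sig tr
    ... | inj₁ (a≡τ , s'~s) = inj₁ (a≡τ , trans s'~s s~t)
    ... | inj₂ ∈sig-s
      with t' , t⟶*t' , t'~t , t'' , t'⟶t'' , match
           ← realisedBelow t a (preValue a s') (proj₁ (sig-cong s~t (a , preValue a s')) ∈sig-s)
      = inj₂ (t' , t'' , t⟶*t' , trans s~t (sym t'~t) , t'⟶t'' , preValue-reflects-~ a s' t'' match)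

lemma2 : ∀ {n m} (L : LTS n m) (τ : Fin m) (A> : Fin m → Bool) →
    IsWellFoundedPartition L A> → T (A> τ) →
    (h : ℕ → ℕ → Sig m → ℕ) → (∀ i → IsBijection (h (suc i))) →
    (π : ℕ → Fin n → ℕ) (sig : ℕ → Fin n → Sig m) →
    IsInductiveBranchingPartition L τ A> h π sig →
    (i : ℕ) →
    (∀ s t → (π i s ≡ π i t → π (suc i) s ≡ π (suc i) t) ×
             (π (suc i) s ≡ π (suc i) t → π i s ≡ π i t)) →
    IsBranchingBisim L τ (λ s t → π i s ≡ π i t)
lemma2 L τ A> wf τ∈A> h h-bij π sig ibp i stable =
  StablePartition.isBranchingBisim L τ A> wf τ∈A> h h-bij π sig ibp i stable
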